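{- Assume the setting described in the context, with $\ell$, $u_i$, $v_i$ as defined there. For each $i=2,3,\ldots$, the subsequence of $\pi$ consisting of all terms of $\pi$ not exceeding $\pi(v_i)$ is the unique subsequence of $\pi$ of its order isomorphism type. Moreover, the permutation $\beta=\beta(1)\cdots\beta(n_i)$ order isomorphic to this subsequence is the longest permutation in $X$ satisfying: (1) $\beta(1),\ldots,\beta(u_{i-1})$ is order isomorphic to $\pi(1),\ldots,\pi(u_{i-1})$; and (2) $\beta(v_i)$ is the largest term of $\beta$.
   Context: A permutation of length $n$ is an arrangement of $1,\ldots,n$; order isomorphism means same relative order; $\alpha\preceq\beta$ means $\alpha$ is order isomorphic to a subsequence of $\beta$, and a sequence involves $\gamma$ if $\gamma\preceq$ it. A closed set is a set of finite permutations closed downward under $\preceq$; its basis is the set of $\preceq$-minimal permutations not in it. $\mathrm{Sub}(\pi)$ is the set of finite permutations order isomorphic to finite subsequences of $\pi$. For permutations $\alpha$ (length $m$) and $\beta$, $\alpha\oplus\beta$ is $\alpha$ followed by $\beta$ with entries increased by $m$; a finite permutation is indecomposable if it is not $\alpha\oplus\beta$ with both nonempty, and each finite permutation is uniquely $\beta_1\oplus\cdots\oplus\beta_s$ with indecomposable $\beta_j$, $\beta_s$ its final sum component. Sum components of $\pi:\mathbb{N}\to\mathbb{N}$: $n\ge1$ is a cut point if $\{\pi(1),\ldots,\pi(n)\}=\{1,\ldots,n\}$; sum components are the segments between consecutive cut points, plus the infinite segment after the last cut point if there are finitely many (the final component). Setting: $\pi:\mathbb{N}\to\mathbb{N}$ is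 a bijection such that $X=\mathrm{Sub}(\pi)$ has a finite basis $B$; $C$ is the set of final sum components of elements of $B$; $\pi$ has finitely many sum components and its final (infinite) component involves an element of $C$. $\ell$ is the largest position of $\pi$ that is a term of some subsequence of $\pi$ order isomorphic to an element of $C$ (such a largest position exists, and it lies in the final sum component). Define $u_0=\ell$ and for $i\ge1$: $v_i$ is the position $p\le u_{i-1}$ with $\pi(p)=\max\{\pi(q):q\le u_{i-1}\}$, and $u_i=\max\{q:\pi(q)\le\pi(v_i)\}$. $n_i$ denotes the number of terms of $\pi$ not exceeding $\pi(v_i)$. -}

module Defs where

-- Conventions: positions and values are 0-based (paper position p+1 = our p,
-- paper value k+1 = our value k).  A finite permutation of length n is a
-- list that is a rearrangement of 0,...,n-1.  A (finite) subsequence of an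
-- infinite sequence π : ℕ → ℕ is given by a strictly increasing list of
-- positions ps, with terms  map π ps.

open import Data.Nat using (ℕ; zero; suc; _+_; _∸_; _≤_; _<_)
open import Data.List using (List; []; _∷_; _++_; map; length; upTo; take; filter; lookup)
open import Data.List.Membership.Propositional using (_∈_)
open import Data.List.Relation.Unary.All using (All)
open import Data.List.Relation.Unary.AllPairs using (AllPairs)
open import Data.List.Relation.Binary.Pointwise using (Pointwise)
open import Data.List.Relation.Binary.Permutation.Propositional using (_↭_)
open import Data.List.Relation.Binary.Sublist.Propositional using (_⊆_)
open import Data.Fin using (fromℕ<)
open import Data.Product using (Σ; ∃; ∃-syntax; _×_)
open import Data.Sum using (_⊎_)
open import Function.Bundles using (_⇔_)
open import Relation.Nullary using (¬_)
open import Relation.Binary.PropositionalEquality using (_≡_; _≢_)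
open import Data.Nat using (_≤?_)

IsPerm : List ℕ → Set
IsPerm xs = xs ↭ upTo (length xs)

data OrdIso : List ℕ → List ℕ → Set where
  [] : OrdIso [] []
  _∷_ : ∀ {x y xs ys} →
        Pointwise (λ x′ y′ → ((x < x′) ⇔ (y < y′)) × ((x′ < x) ⇔ (y′ < y))) xs ys →
        OrdIso xs ys → OrdIso (x ∷ xs) (y ∷ ys)

_≼_ : List ℕ → List ℕ → Set
α ≼ β = ∃[ ys ] (ys ⊆ β × OrdIso α ys)

Increasing : List ℕ → Set
Increasing = AllPairs _<_

InSub : (ℕ → ℕ) → List ℕ → Set
InSub π α = ∃[ ps ] (Increasing ps × OrdIso α (map π ps))

InX : (ℕ → ℕ) → List ℕ → Set
InX π α = IsPerm α × InSub π α

IsMinimalNonMember : (ℕ → ℕ) → List ℕ → Set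
IsMinimalNonMember π σ =
  IsPerm σ × ¬ InX π σ × (∀ α → IsPerm α → α ≼ σ → α ≢ σ → InX π α)

IsBasis : (ℕ → ℕ) → List (List ℕ) → Set
IsBasis π B =
  (∀ σ → σ ∈ B → IsMinimalNonMember π σ) ×
  (∀ σ → IsMinimalNonMember π σ → σ ∈ B)

_⊕_ : List ℕ → List ℕ → List ℕ
α ⊕ β = α ++ map (length α +_) β

Indecomposable : List ℕ → Set
Indecomposable γ =
  ∀ α β → IsPerm α → IsPerm β → α ≢ [] → β ≢ [] → γ ≢ α ⊕ β

FinalComponent : List ℕ → List ℕ → Set
FinalComponent β γ =
  ∃[ α ] (IsPerm α × IsPerm γ × γ ≢ [] × Indecomposable γ × β ≡ α ⊕ γ)

InC : List (List ℕ) → List ℕ → Set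
InC B γ = ∃[ b ] (b ∈ B × FinalComponent b γ)

-- cut point of π (paper position n ≥ 1; {π(1..n)} = {1..n}), 0-based form:
-- n ≥ 1 and {π 0, ..., π (n-1)} = {0, ..., n-1}
IsCut : (ℕ → ℕ) → ℕ → Set
IsCut π n =
  1 ≤ n × (∀ i → i < n → π i < n) × (∀ j → j < n → ∃[ i ] (i < n × π i ≡ j))

-- π has finitely many sum components, the final (infinite) one starts at
-- position K (K = 0 or K the last cut point), and that final component
-- involves an element of C
FinalComponentInvolvesC : (ℕ → ℕ) → List (List ℕ) → Set
FinalComponentInvolvesC π B =
  ∃[ K ] ((K ≡ 0 ⊎ IsCut π K) × (∀ n → IsCut π n → n ≤ K) ×
          ∃[ γ ] (InC B γ × ∃[ ps ] (Increasing ps × All (K ≤_) ps × OrdIso γ (map π ps))))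

TermOfCCopy : (ℕ → ℕ) → List (List ℕ) → ℕ → Set
TermOfCCopy π B p =
  ∃[ γ ] (InC B γ × ∃[ ps ] (Increasing ps × p ∈ ps × OrdIso γ (map π ps)))

IsEll : (ℕ → ℕ) → List (List ℕ) → ℕ → Set
IsEll π B ℓ = TermOfCCopy π B ℓ × (∀ p → TermOfCCopy π B p → p ≤ ℓ)

IsUV : (ℕ → ℕ) → ℕ → (ℕ → ℕ) → (ℕ → ℕ) → Set
IsUV π ℓ u v =
  u 0 ≡ ℓ ×
  (∀ i → v (suc i) ≤ u i × (∀ q → q ≤ u i → π q ≤ π (v (suc i)))) ×
  (∀ i → π (u (suc i)) ≤ π (v (suc i)) × (∀ q → π q ≤ π (v (suc i)) → q ≤ u (suc i)))

PositionsUpTo : (ℕ → ℕ) → ℕ → ℕ → List ℕ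
PositionsUpTo π c bound = filter (λ q → π q ≤? c) (upTo (suc bound))

LargestAt : List ℕ → ℕ → Set
LargestAt β p = Σ (p < length β) λ lt → All (_≤ lookup β (fromℕ< lt)) β

-- conditions (1) and (2) of the lemma (0-based: positions 0..u(i-1))
Conds : (ℕ → ℕ) → (ℕ → ℕ) → (ℕ → ℕ) → ℕ → List ℕ → Set
Conds π u v i β =
  OrdIso (take (suc (u i)) β) (map π (upTo (suc (u i)))) × LargestAt β (v (suc i))

module Submission where

-- Write U = u (i-1) and V = v i.  Every position q ≤ U has π q ≤ π V, so the increasing
-- list ps of positions of the terms ≤ π V begins with 0, 1, …, U, and π V is its largest
-- term.  Conversely, let qs be increasing positions whose first U + 1 terms form a copy of
-- π 0 … π U, and put g k = qs k.  Then g is inflationary, and a fixed point of g fixes every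
-- position below it.  g fixes ℓ: it maps an occurrence of an element of C through ℓ to one
-- through g ℓ, so g ℓ ≤ ℓ.  If g fixes u (m-1), it fixes v m ≤ u (m-1), so
-- π (g (u m)) ≤ π (v m) and g (u m) ≤ u m by the choice of u m.  Hence g V = V, and if the
-- copy also has its largest term at V, then every term of qs is ≤ π V, i.e. qs ⊆ ps.  This
-- gives the uniqueness of ps and the maximality of its pattern.

open import Defs
open import Data.Nat using (ℕ; zero; suc; _≤_; _<_; _⊓_; z≤n; s≤s; z<s; s<s; _≤?_)
open import Data.Nat.Properties
open import Data.List using (List; []; _∷_; map; length; upTo; applyUpTo; take; lookup)
open import Data.List.Properties using (length-map; length-upTo; length-take; map-∘)
open import Data.List.Membership.Propositional using (_∈_)
open import Data.List.Membership.Propositional.Properties using (∈-map⁺; ∈-filter⁺; ∈-filter⁻; ∈-upTo⁺)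
open import Data.List.Relation.Unary.Any using (here; there)
open import Data.List.Relation.Unary.All as All using (All; []; _∷_)
import Data.List.Relation.Unary.All.Properties as All
open import Data.List.Relation.Unary.AllPairs using ([]; _∷_)
import Data.List.Relation.Unary.AllPairs.Properties as AllPairs
open import Data.List.Relation.Binary.Pointwise using (Pointwise; []; _∷_; Pointwise-≡⇒≡)
open import Data.List.Relation.Binary.Sublist.Propositional using (_⊆_)
open import Data.List.Relation.Binary.Sublist.Heterogeneous using (minimum; _∷ʳ_; _∷_)
open import Data.List.Relation.Binary.Sublist.Heterogeneous.Properties using (length-mono-≤; toPointwise)
open import Data.Fin using (fromℕ<)
open import Data.Product using (∃-syntax; _×_; _,_; proj₁; proj₂; uncurry)
open import Data.Sum using (inj₁; inj₂)
open import Data.Empty using (⊥-elim)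
open import Function using (_∘_)
open import Function.Bundles using (_⇔_; mk⇔; Equivalence)
open import Function.Construct.Identity using (⇔-id)
open import Function.Construct.Symmetry using (⇔-sym)
open import Function.Construct.Composition using (_⇔-∘_)
open import Function.Definitions using (Bijective)
open import Relation.Binary.PropositionalEquality using (_≡_; refl; sym; trans; cong; subst; subst₂)

-- Indexing by a natural number, so that entries of two lists of equal length
-- can be compared at the same index without casting between `Fin` types.
at : List ℕ → ℕ → ℕ
at []       _       = 0
at (x ∷ _)  zero    = x
at (_ ∷ xs) (suc k) = at xs k

at-map : ∀ (f : ℕ → ℕ) xs {k} → k < length xs → at (map f xs) k ≡ f (at xs k)
at-map f (x ∷ xs) {zero}  _         = refl
at-map f (x ∷ xs) {suc k} (s≤s k<n) = at-map f xs k<n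

at-take : ∀ n (xs : List ℕ) {k} → k < n → at (take n xs) k ≡ at xs k
at-take (suc n) []       _         = refl
at-take (suc n) (x ∷ xs) {zero}  _ = refl
at-take (suc n) (x ∷ xs) {suc k} (s≤s k<n) = at-take n xs k<n

at-applyUpTo : ∀ (f : ℕ → ℕ) {n k} → k < n → at (applyUpTo f n) k ≡ f k
at-applyUpTo f {suc n} {zero}  _         = refl
at-applyUpTo f {suc n} {suc k} (s≤s k<n) = at-applyUpTo (f ∘ suc) k<n

lookup≡at : ∀ xs {k} (k<n : k < length xs) → lookup xs (fromℕ< k<n) ≡ at xs k
lookup≡at (x ∷ xs) {zero}  _         = refl
lookup≡at (x ∷ xs) {suc k} (s≤s k<n) = lookup≡at xs k<n

at-∈ : ∀ xs {k} → k < length xs → at xs k ∈ xs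
at-∈ (x ∷ xs) {zero}  _         = here refl
at-∈ (x ∷ xs) {suc k} (s≤s k<n) = there (at-∈ xs k<n)

∈⇒at : ∀ {x xs} → x ∈ xs → ∃[ k ] (k < length xs × at xs k ≡ x)
∈⇒at (here refl) = 0 , z<s , refl
∈⇒at (there x∈) with ∈⇒at x∈
... | k , k<n , eq = suc k , s<s k<n , eq

All⇒at : ∀ {P : ℕ → Set} {xs} → All P xs → ∀ {k} → k < length xs → P (at xs k)
All⇒at {xs = xs} all k<n = All.lookup all (at-∈ xs k<n)

at⇒All : ∀ {P : ℕ → Set} {xs} → (∀ {k} → k < length xs → P (at xs k)) → All P xs
at⇒All {P} h = All.tabulate λ x∈ → let (_ , k<n , eq) = ∈⇒at x∈ in subst P eq (h k<n)

Pointwise⇒at : ∀ {R : ℕ → ℕ → Set} {xs ys} → Pointwise R xs ys →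
               ∀ {k} → k < length xs → R (at xs k) (at ys k)
Pointwise⇒at (r ∷ _)  {zero}  _         = r
Pointwise⇒at (_ ∷ rs) {suc k} (s≤s k<n) = Pointwise⇒at rs k<n

at⇒Pointwise : ∀ {R : ℕ → ℕ → Set} {xs ys} → length xs ≡ length ys →
               (∀ {k} → k < length xs → R (at xs k) (at ys k)) → Pointwise R xs ys
at⇒Pointwise {xs = []}     {[]}     _  _ = []
at⇒Pointwise {xs = x ∷ xs} {y ∷ ys} eq h =
  h z<s ∷ at⇒Pointwise (suc-injective eq) (h ∘ s<s)

SameOrderAt : List ℕ → List ℕ → Set
SameOrderAt xs ys = ∀ {i k} → i < length xs → k < length xs → (at xs i < at xs k) ⇔ (at ys i < at ys k)

record OrdIsoAt (xs ys : List ℕ) : Set where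
  constructor mkOrdIsoAt
  field
    length-≡ : length xs ≡ length ys
    order-⇔  : SameOrderAt xs ys

toOrdIsoAt : ∀ {xs ys} → OrdIso xs ys → OrdIsoAt xs ys
toOrdIsoAt []               = mkOrdIsoAt refl λ ()
toOrdIsoAt {x ∷ xs} {y ∷ ys} (heads ∷ tails) = mkOrdIsoAt (cong suc length-≡) order
  where
  open OrdIsoAt (toOrdIsoAt tails)
  order : SameOrderAt (x ∷ xs) (y ∷ ys)
  order {zero}  {zero}  _ _ = mk⇔ (⊥-elim ∘ <-irrefl refl) (⊥-elim ∘ <-irrefl refl)
  order {zero}  {suc k} _ (s≤s k<n) = proj₁ (Pointwise⇒at heads k<n)
  order {suc i} {zero}  (s≤s i<n) _ = proj₂ (Pointwise⇒at heads i<n)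
  order {suc i} {suc k} (s≤s i<n) (s≤s k<n) = order-⇔ i<n k<n

fromOrdIsoAt : ∀ {xs ys} → OrdIsoAt xs ys → OrdIso xs ys
fromOrdIsoAt {[]}     {[]}     _                   = []
fromOrdIsoAt {x ∷ xs} {y ∷ ys} (mkOrdIsoAt eq ord) =
  at⇒Pointwise (suc-injective eq) (λ k<n → ord z<s (s<s k<n) , ord (s<s k<n) z<s)
  ∷ fromOrdIsoAt (mkOrdIsoAt (suc-injective eq) (λ i<n k<n → ord (s<s i<n) (s<s k<n)))

OrdIso-length : ∀ {xs ys} → OrdIso xs ys → length xs ≡ length ys
OrdIso-length = OrdIsoAt.length-≡ ∘ toOrdIsoAt

OrdIso-refl : ∀ xs → OrdIso xs xs
OrdIso-refl xs = fromOrdIsoAt (mkOrdIsoAt refl λ _ _ → ⇔-id _)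

at-increasing : ∀ {xs} → Increasing xs → ∀ {i k} → i < k → k < length xs → at xs i < at xs k
at-increasing (x< ∷ _)   {zero}  {suc k} _         (s≤s k<n) = All⇒at x< k<n
at-increasing (_ ∷ inc) {suc i} {suc k} (s≤s i<k) (s≤s k<n) = at-increasing inc i<k k<n

at-increasing-≤ : ∀ {xs} → Increasing xs → ∀ {i k} → i ≤ k → k < length xs → at xs i ≤ at xs k
at-increasing-≤ inc i≤k k<n with m≤n⇒m<n∨m≡n i≤k
... | inj₁ i<k  = <⇒≤ (at-increasing inc i<k k<n)
... | inj₂ refl = ≤-refl

-- The occurrence of k + 1 lies after that of k, hence at index k + 1 at the latest.
increasing-prefix : ∀ {xs n} → Increasing xs → (∀ {k} → k ≤ n → k ∈ xs) →
                    ∀ {k} → k ≤ n → k < length xs × at xs k ≡ k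
increasing-prefix {xs} inc has {zero} 0≤n with ∈⇒at (has 0≤n)
... | p , p<n , at-p≡0 =
  ≤-<-trans z≤n p<n , n≤0⇒n≡0 (subst (at xs 0 ≤_) at-p≡0 (at-increasing-≤ inc z≤n p<n))
increasing-prefix {xs} inc has {suc k} k<n with increasing-prefix inc has (<⇒≤ k<n) | ∈⇒at (has k<n)
... | k<len , at-k≡k | p , p<len , at-p≡1+k = 1+k<len , ≤-antisym at-1+k≤1+k 1+k≤at-1+k
  where
  k<p : k < p
  k<p = ≰⇒> λ p≤k → 1+n≰n (subst₂ _≤_ at-p≡1+k at-k≡k (at-increasing-≤ inc p≤k k<len))
  1+k<len : suc k < length xs
  1+k<len = ≤-<-trans k<p p<len
  at-1+k≤1+k : at xs (suc k) ≤ suc k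
  at-1+k≤1+k = subst (at xs (suc k) ≤_) at-p≡1+k (at-increasing-≤ inc k<p p<len)
  1+k≤at-1+k : suc k ≤ at xs (suc k)
  1+k≤at-1+k = subst (_< at xs (suc k)) at-k≡k (at-increasing inc (n<1+n k) 1+k<len)

∈-tail : ∀ {x y ys} → y < x → x ∈ y ∷ ys → x ∈ ys
∈-tail y<x (here refl) = ⊥-elim (<-irrefl refl y<x)
∈-tail _   (there x∈)  = x∈

increasing-⊆ : ∀ {xs ys} → Increasing xs → Increasing ys → All (_∈ ys) xs → xs ⊆ ys
increasing-⊆ {[]}              _ _ _ = minimum _
increasing-⊆ {_ ∷ _}  {[]}     _ _ (() ∷ _)
increasing-⊆ {x ∷ xs} {y ∷ ys} (x< ∷ inc-xs) (_ ∷ inc-ys) (here refl ∷ xs∈) =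
  refl ∷ increasing-⊆ inc-xs inc-ys (All.zipWith (uncurry ∈-tail) (x< , xs∈))
increasing-⊆ {x ∷ xs} {y ∷ ys} inc@(x< ∷ _) (y< ∷ inc-ys) x∷xs∈@(there x∈ys ∷ _) =
  y ∷ʳ increasing-⊆ inc inc-ys (All.zipWith (uncurry ∈-tail) (y<x∷xs , x∷xs∈))
  where
  y<x = All.lookup y< x∈ys
  y<x∷xs : All (y <_) (x ∷ xs)
  y<x∷xs = y<x ∷ All.map (<-trans y<x) x<

increasing-⊆-≡ : ∀ {xs ys} → Increasing xs → Increasing ys → All (_∈ ys) xs →
                 length ys ≤ length xs → xs ≡ ys
increasing-⊆-≡ inc-xs inc-ys xs∈ys ys≤xs =
  Pointwise-≡⇒≡ (toPointwise (≤-antisym (length-mono-≤ xs⊆ys) ys≤xs) xs⊆ys)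
  where xs⊆ys = increasing-⊆ inc-xs inc-ys xs∈ys

<⇔<-resp-≡ : ∀ {a b c d a′ b′ c′ d′} → a ≡ a′ → b ≡ b′ → c ≡ c′ → d ≡ d′ →
             (a < b) ⇔ (c < d) → (a′ < b′) ⇔ (c′ < d′)
<⇔<-resp-≡ refl refl refl refl e = e

OrdIso-map-length : ∀ {γ} {f : ℕ → ℕ} {xs} → OrdIso γ (map f xs) → length γ ≡ length xs
OrdIso-map-length {f = f} {xs} γ≅ = trans (OrdIso-length γ≅) (length-map f xs)

OrdIso-map-order : ∀ {γ} {f : ℕ → ℕ} {xs} → OrdIso γ (map f xs) →
                   ∀ {i k} → i < length xs → k < length xs →
                   (at γ i < at γ k) ⇔ (f (at xs i) < f (at xs k))
OrdIso-map-order {γ} {f} {xs} γ≅ i<n k<n =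
  <⇔<-resp-≡ refl refl (at-map f xs i<n) (at-map f xs k<n) (order-⇔ (in-γ i<n) (in-γ k<n))
  where
  open OrdIsoAt (toOrdIsoAt γ≅)
  in-γ : ∀ {i} → i < length xs → i < length γ
  in-γ {i} = subst (i <_) (sym (OrdIso-map-length γ≅))

OrdIso-map⁺ : ∀ {γ} {f : ℕ → ℕ} {xs} → length γ ≡ length xs →
              (∀ {i k} → i < length xs → k < length xs →
                 (at γ i < at γ k) ⇔ (f (at xs i) < f (at xs k))) →
              OrdIso γ (map f xs)
OrdIso-map⁺ {γ} {f} {xs} γ≡xs order =
  fromOrdIsoAt (mkOrdIsoAt (trans γ≡xs (sym (length-map f xs))) order′)
  where
  order′ : SameOrderAt γ (map f xs)
  order′ i<γ k<γ = <⇔<-resp-≡ refl refl (sym (at-map f xs i<xs)) (sym (at-map f xs k<xs))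
                              (order i<xs k<xs)
    where
    i<xs = subst (_ <_) γ≡xs i<γ
    k<xs = subst (_ <_) γ≡xs k<γ

PrefixPattern : (ℕ → ℕ) → ℕ → List ℕ → Set
PrefixPattern f n γ = n < length γ × (∀ {i k} → i ≤ n → k ≤ n → (at γ i < at γ k) ⇔ (f i < f k))

module _ (f : ℕ → ℕ) (n : ℕ) (γ : List ℕ) where

  private
    length-upTo-pattern : length (map f (upTo (suc n))) ≡ suc n
    length-upTo-pattern = trans (length-map f (upTo (suc n))) (length-upTo (suc n))

    at-upTo-pattern : ∀ {i} → i ≤ n → at (map f (upTo (suc n))) i ≡ f i
    at-upTo-pattern {i} i≤n =
      trans (at-map f (upTo (suc n)) (subst (i <_) (sym (length-upTo (suc n))) (s≤s i≤n)))
            (cong f (at-applyUpTo (λ j → j) (s≤s i≤n)))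

  toPrefixPattern : OrdIso (take (suc n) γ) (map f (upTo (suc n))) → PrefixPattern f n γ
  toPrefixPattern prefix≅ = m⊓n≡m⇒m≤n length-prefix , order
    where
    open OrdIsoAt (toOrdIsoAt prefix≅)
    length-prefix : suc n ⊓ length γ ≡ suc n
    length-prefix = trans (sym (length-take (suc n) γ)) (trans length-≡ length-upTo-pattern)
    in-prefix : ∀ {i} → i ≤ n → i < length (take (suc n) γ)
    in-prefix i≤n = subst (_ <_) (sym (trans length-≡ length-upTo-pattern)) (s≤s i≤n)
    order : ∀ {i k} → i ≤ n → k ≤ n → (at γ i < at γ k) ⇔ (f i < f k)
    order i≤n k≤n = <⇔<-resp-≡ (at-take (suc n) γ (s≤s i≤n)) (at-take (suc n) γ (s≤s k≤n))
                              (at-upTo-pattern i≤n) (at-upTo-pattern k≤n)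
                              (order-⇔ (in-prefix i≤n) (in-prefix k≤n))

  fromPrefixPattern : PrefixPattern f n γ → OrdIso (take (suc n) γ) (map f (upTo (suc n)))
  fromPrefixPattern (n<γ , order) = fromOrdIsoAt (mkOrdIsoAt length-prefix order′)
    where
    length-prefix : length (take (suc n) γ) ≡ length (map f (upTo (suc n)))
    length-prefix = trans (length-take (suc n) γ) (trans (m≤n⇒m⊓n≡m n<γ) (sym length-upTo-pattern))
    order′ : SameOrderAt (take (suc n) γ) (map f (upTo (suc n)))
    order′ {i} {k} i<prefix k<prefix =
      <⇔<-resp-≡ (sym (at-take (suc n) γ i<1+n)) (sym (at-take (suc n) γ k<1+n))
                 (sym (at-upTo-pattern (≤-pred i<1+n))) (sym (at-upTo-pattern (≤-pred k<1+n)))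
                 (order (≤-pred i<1+n) (≤-pred k<1+n))
      where
      bound : ∀ {j} → j < length (take (suc n) γ) → j < suc n
      bound = subst (_ <_) (trans length-prefix length-upTo-pattern)
      i<1+n = bound i<prefix
      k<1+n = bound k<prefix

LargestAt⁺ : ∀ {β p} (p<β : p < length β) → (∀ {k} → k < length β → at β k ≤ at β p) → LargestAt β p
LargestAt⁺ {β} p<β largest = p<β , subst (λ m → All (_≤ m) β) (sym (lookup≡at β p<β)) (at⇒All largest)

LargestAt⁻ : ∀ {β p} → LargestAt β p → ∀ {k} → k < length β → at β k ≤ at β p
LargestAt⁻ {β} (p<β , largest) = All⇒at (subst (λ m → All (_≤ m) β) (lookup≡at β p<β) largest)

record PrefixCopy (π : ℕ → ℕ) (n : ℕ) (g : ℕ → ℕ) : Set where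
  field
    strictMono : ∀ {i k} → i < k → k ≤ n → g i < g k
    order-⇔    : ∀ {i k} → i ≤ n → k ≤ n → (π i < π k) ⇔ (π (g i) < π (g k))

PrefixPattern⇒PrefixCopy : ∀ {π n γ qs} → Increasing qs → OrdIso γ (map π qs) →
                           PrefixPattern π n γ → PrefixCopy π n (at qs)
PrefixPattern⇒PrefixCopy {π} {n} {γ} {qs} inc γ≅ (n<γ , order) = record
  { strictMono = λ i<k k≤n → at-increasing inc i<k (in-qs k≤n)
  ; order-⇔    = λ i≤n k≤n → OrdIso-map-order γ≅ (in-qs i≤n) (in-qs k≤n) ⇔-∘ ⇔-sym (order i≤n k≤n)
  }
  where
  in-qs : ∀ {k} → k ≤ n → k < length qs
  in-qs k≤n = ≤-<-trans k≤n (subst (n <_) (OrdIso-map-length γ≅) n<γ)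

module _ {π n g} (copy : PrefixCopy π n g) where
  open PrefixCopy copy

  inflationary : ∀ {k} → k ≤ n → k ≤ g k
  inflationary {zero}  _   = z≤n
  inflationary {suc k} k<n = ≤-<-trans (inflationary (<⇒≤ k<n)) (strictMono (n<1+n k) k<n)

  fixed-below : ∀ {m} → m ≤ n → g m ≡ m → ∀ {k} → k ≤ m → g k ≡ k
  fixed-below {zero}  _   g0≡0 z≤n = g0≡0
  fixed-below {suc m} m<n g≡ k≤1+m with m≤n⇒m<n∨m≡n k≤1+m
  ... | inj₂ refl      = g≡
  ... | inj₁ (s≤s k≤m) = fixed-below (<⇒≤ m<n) (≤-antisym gm≤m (inflationary (<⇒≤ m<n))) k≤m
    where
    gm≤m : g m ≤ m
    gm≤m = ≤-pred (subst (g m <_) g≡ (strictMono (n<1+n m) m<n))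

  map-increasing : ∀ {xs} → Increasing xs → All (_≤ n) xs → Increasing (map g xs)
  map-increasing {[]}     []           []         = []
  map-increasing {x ∷ xs} (x< ∷ inc) (_ ∷ xs≤n) =
    All.map⁺ (All.zipWith (uncurry strictMono) (x< , xs≤n)) ∷ map-increasing inc xs≤n

  map-OrdIso : ∀ {γ xs} → OrdIso γ (map π xs) → All (_≤ n) xs → OrdIso γ (map π (map g xs))
  map-OrdIso {γ} {xs} γ≅ xs≤n = subst (OrdIso γ) (map-∘ xs) (OrdIso-map⁺ (OrdIso-map-length γ≅) order)
    where
    order : ∀ {i k} → i < length xs → k < length xs →
            (at γ i < at γ k) ⇔ (π (g (at xs i)) < π (g (at xs k)))
    order i<xs k<xs = order-⇔ (All⇒at xs≤n i<xs) (All⇒at xs≤n k<xs) ⇔-∘ OrdIso-map-order γ≅ i<xs k<xs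

module Setting (π : ℕ → ℕ) {B ℓ} (ell : IsEll π B ℓ) (u v : ℕ → ℕ) (uv : IsUV π ℓ u v) where

  v≤u : ∀ m → v (suc m) ≤ u m
  v≤u m = proj₁ (proj₁ (proj₂ uv) m)

  ≤u⇒π≤πv : ∀ m {q} → q ≤ u m → π q ≤ π (v (suc m))
  ≤u⇒π≤πv m = proj₂ (proj₁ (proj₂ uv) m) _

  π≤πv⇒≤u : ∀ m {q} → π q ≤ π (v (suc m)) → q ≤ u (suc m)
  π≤πv⇒≤u m = proj₂ (proj₂ (proj₂ uv) m) _

  u-monotone : ∀ m → u m ≤ u (suc m)
  u-monotone m = π≤πv⇒≤u m (≤u⇒π≤πv m ≤-refl)

  module _ {n g} (copy : PrefixCopy π n g) where
    open PrefixCopy copy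

    ℓ-fixed : ℓ ≤ n → g ℓ ≡ ℓ
    ℓ-fixed ℓ≤n with proj₁ ell
    ... | γ , γ∈C , qs , inc , ℓ∈qs , γ≅ = ≤-antisym gℓ≤ℓ (inflationary copy ℓ≤n)
      where
      qs≤n : All (_≤ n) qs
      qs≤n = All.tabulate λ q∈qs → ≤-trans (proj₂ ell _ (γ , γ∈C , qs , inc , q∈qs , γ≅)) ℓ≤n
      gℓ≤ℓ : g ℓ ≤ ℓ
      gℓ≤ℓ = proj₂ ell (g ℓ) (γ , γ∈C , map g qs , map-increasing copy inc qs≤n ,
                                ∈-map⁺ g ℓ∈qs , map-OrdIso copy γ≅ qs≤n)

    u-fixed : ∀ m → u m ≤ n → g (u m) ≡ u m
    u-fixed zero    u0≤n = subst (λ x → g x ≡ x) (sym u0≡ℓ) (ℓ-fixed (subst (_≤ n) u0≡ℓ u0≤n))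
      where u0≡ℓ = proj₁ uv
    u-fixed (suc m) u≤n = ≤-antisym (π≤πv⇒≤u m πgu≤πv) (inflationary copy u≤n)
      where
      um≤n = ≤-trans (u-monotone m) u≤n
      v≤n  = ≤-trans (v≤u m) um≤n
      gv≡v : g (v (suc m)) ≡ v (suc m)
      gv≡v = fixed-below copy um≤n (u-fixed m um≤n) (v≤u m)
      πgu≤πv : π (g (u (suc m))) ≤ π (v (suc m))
      πgu≤πv = ≮⇒≥ λ πv<πgu → ≤⇒≯ (proj₁ (proj₂ (proj₂ uv) m))
                 (Equivalence.from (order-⇔ v≤n u≤n) (subst (λ x → π x < _) (sym gv≡v) πv<πgu))

    v-fixed : ∀ m → u m ≤ n → g (v (suc m)) ≡ v (suc m)
    v-fixed m um≤n = fixed-below copy um≤n (u-fixed m um≤n) (v≤u m)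

  module Positions (i : ℕ) where

    U = u i
    V = v (suc i)

    ps : List ℕ
    ps = PositionsUpTo π (π V) (u (suc i))

    ps-increasing : Increasing ps
    ps-increasing = AllPairs.filter⁺ (λ q → π q ≤? π V) (AllPairs.applyUpTo⁺₁ (λ q → q) _ (λ q<r _ → q<r))

    ∈ps⁻ : ∀ {q} → q ∈ ps → π q ≤ π V
    ∈ps⁻ q∈ps = proj₂ (∈-filter⁻ (λ q → π q ≤? π V) q∈ps)

    ∈ps⁺ : ∀ {q} → π q ≤ π V → q ∈ ps
    ∈ps⁺ πq≤πV = ∈-filter⁺ (λ q → π q ≤? π V) (∈-upTo⁺ (s≤s (π≤πv⇒≤u i πq≤πV))) πq≤πV

    ps-prefix : ∀ {k} → k ≤ U → k < length ps × at ps k ≡ k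
    ps-prefix = increasing-prefix ps-increasing (∈ps⁺ ∘ ≤u⇒π≤πv i)

    OrdIso⇒Conds : ∀ {β} → OrdIso β (map π ps) → Conds π u v i β
    OrdIso⇒Conds {β} β≅ = fromPrefixPattern π U β (in-β ≤-refl , order) , LargestAt⁺ (in-β (v≤u i)) largest
      where
      in-ps : ∀ {k} → k ≤ U → k < length ps
      in-ps = proj₁ ∘ ps-prefix
      in-β : ∀ {k} → k ≤ U → k < length β
      in-β {k} = subst (k <_) (sym (OrdIso-map-length β≅)) ∘ in-ps
      π-at-ps : ∀ {k} → k ≤ U → π (at ps k) ≡ π k
      π-at-ps = cong π ∘ proj₂ ∘ ps-prefix
      order : ∀ {i k} → i ≤ U → k ≤ U → (at β i < at β k) ⇔ (π i < π k)
      order i≤U k≤U = <⇔<-resp-≡ refl refl (π-at-ps i≤U) (π-at-ps k≤U)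
                                 (OrdIso-map-order β≅ (in-ps i≤U) (in-ps k≤U))
      largest : ∀ {k} → k < length β → at β k ≤ at β V
      largest k<β = ≮⇒≥ λ βV<βk → ≤⇒≯ (∈ps⁻ (at-∈ ps k<ps))
        (subst (_< π (at ps _)) (π-at-ps (v≤u i))
               (Equivalence.to (OrdIso-map-order β≅ (in-ps (v≤u i)) k<ps) βV<βk))
        where k<ps = subst (_ <_) (OrdIso-map-length β≅) k<β

    Conds⇒⊆ps : ∀ {γ qs} → Increasing qs → OrdIso γ (map π qs) → Conds π u v i γ → All (_∈ ps) qs
    Conds⇒⊆ps {γ} {qs} inc γ≅ (prefix≅ , largestV) = at⇒All (∈ps⁺ ∘ below-V)
      where
      γ-prefix = toPrefixPattern π U γ prefix≅
      qV≡V : at qs V ≡ V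
      qV≡V = v-fixed (PrefixPattern⇒PrefixCopy inc γ≅ γ-prefix) i ≤-refl
      V<qs : V < length qs
      V<qs = ≤-<-trans (v≤u i) (subst (U <_) (OrdIso-map-length γ≅) (proj₁ γ-prefix))
      below-V : ∀ {k} → k < length qs → π (at qs k) ≤ π V
      below-V k<qs = ≮⇒≥ λ πV<πqk → ≤⇒≯ (LargestAt⁻ largestV k<γ)
        (Equivalence.from (OrdIso-map-order γ≅ V<qs k<qs) (subst (λ x → π x < _) (sym qV≡V) πV<πqk))
        where k<γ = subst (_ <_) (sym (OrdIso-map-length γ≅)) k<qs

lemma6 : (π : ℕ → ℕ) → Bijective _≡_ _≡_ π →
         (B : List (List ℕ)) → IsBasis π B →
         FinalComponentInvolvesC π B →
         (ℓ : ℕ) → IsEll π B ℓ →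
         (u v : ℕ → ℕ) → IsUV π ℓ u v →
         (j : ℕ) →
         let ps = PositionsUpTo π (π (v (suc (suc j)))) (u (suc (suc j))) in
         ((qs : List ℕ) → Increasing qs → OrdIso (map π qs) (map π ps) → qs ≡ ps) ×
         ((β : List ℕ) → IsPerm β → OrdIso β (map π ps) →
           InX π β × Conds π u v (suc j) β ×
           ((γ : List ℕ) → InX π γ → Conds π u v (suc j) γ → length γ ≤ length β))
lemma6 π _ B _ _ ℓ ell u v uv j = unique , extremal
  where
  open Setting π ell u v uv
  open Positions (suc j)

  unique : (qs : List ℕ) → Increasing qs → OrdIso (map π qs) (map π ps) → qs ≡ ps
  unique qs inc qs≅ps = increasing-⊆-≡ inc ps-increasing
    (Conds⇒⊆ps inc (OrdIso-refl (map π qs)) (OrdIso⇒Conds qs≅ps))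
    (≤-reflexive (trans (sym (OrdIso-map-length qs≅ps)) (length-map π qs)))

  extremal : (β : List ℕ) → IsPerm β → OrdIso β (map π ps) →
             InX π β × Conds π u v (suc j) β ×
             ((γ : List ℕ) → InX π γ → Conds π u v (suc j) γ → length γ ≤ length β)
  extremal β perm β≅ = (perm , ps , ps-increasing , β≅) , OrdIso⇒Conds β≅ , longest
    where
    longest : (γ : List ℕ) → InX π γ → Conds π u v (suc j) γ → length γ ≤ length β
    longest γ (_ , qs , inc , γ≅) conds = begin
      length γ  ≡⟨ OrdIso-map-length γ≅ ⟩
      length qs ≤⟨ length-mono-≤ (increasing-⊆ inc ps-increasing (Conds⇒⊆ps inc γ≅ conds)) ⟩
      length ps ≡⟨ OrdIso-map-length β≅ ⟨
      length β  ∎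
      where open ≤-Reasoning
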